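{- Let $G$ be a finite connected simple graph on $n$ vertices with minimum valence $\delta(G)\ge\lfloor n/2\rfloor+1$. Then $\operatorname{gon}(G)=\operatorname{mfgon}(G)=n-\alpha(G)$.
   Context: The valence of a vertex is the number of incident edges; $\delta(G)$ is the minimum valence. $\alpha(G)$ is the independence number (maximum size of a set of pairwise non-adjacent vertices). A divisor is an integer combination $D=\sum_vD(v)(v)$ of vertices, degree $\sum_vD(v)$, effective if all $D(v)\ge0$. Divisors are equivalent if their difference lies in the integer column space of the Laplacian. The rank $r(D)$ is $-1$ if $D$ is not equivalent to an effective divisor, else the largest $r\ge0$ such that $D-E$ is equivalent to an effective divisor for all effective $E$ of degree $r$. $\operatorname{gon}(G)$ is the minimum degree of a positive-rank divisor; $\operatorname{mfgon}(G)$ is the minimum degree of a positive-rank effective divisor $D$ with $D(v)\le1$ for all $v$. -}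

module Defs where

open import Data.Nat as ℕ using (ℕ; zero; suc; _∸_; _/_)
open import Data.Integer as ℤ using (ℤ; +_; _+_; _-_; _*_; 0ℤ)
open import Data.Fin using (Fin; zero; suc)
open import Data.Fin.Subset using (Subset; _∈_; ∣_∣)
open import Data.Bool using (Bool; true; false; if_then_else_)
open import Data.Product using (Σ; _×_; ∃; ∃-syntax)
open import Data.List using (List; []; _∷_)
open import Relation.Binary.PropositionalEquality using (_≡_)

record Graph (n : ℕ) : Set where
  field
    adj    : Fin n → Fin n → Bool
    sym    : ∀ u v → adj u v ≡ adj v u
    irrefl : ∀ v → adj v v ≡ false
open Graph public

sumℤ : (n : ℕ) → (Fin n → ℤ) → ℤ
sumℤ zero    f = 0ℤ
sumℤ (suc n) f = f zero + sumℤ n (λ i → f (suc i))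

countTrue : (n : ℕ) → (Fin n → Bool) → ℕ
countTrue zero    f = 0
countTrue (suc n) f = (if f zero then 1 else 0) ℕ.+ countTrue n (λ i → f (suc i))

data Walk {n : ℕ} (G : Graph n) : Fin n → Fin n → Set where
  here : ∀ v → Walk G v v
  step : ∀ u w v → adj G u w ≡ true → Walk G w v → Walk G u v

Connected : {n : ℕ} → Graph n → Set
Connected {n} G = ∀ (u v : Fin n) → Walk G u v

valence : {n : ℕ} → Graph n → Fin n → ℕ
valence {n} G v = countTrue n (adj G v)

MinValenceAtLeast : {n : ℕ} → Graph n → ℕ → Set
MinValenceAtLeast G k = ∀ v → k ℕ.≤ valence G v

Independent : {n : ℕ} → Graph n → Subset n → Set
Independent G S = ∀ u v → u ∈ S → v ∈ S → adj G u v ≡ false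

IsIndependenceNumber : {n : ℕ} → Graph n → ℕ → Set
IsIndependenceNumber {n} G a =
  (Σ (Subset n) λ S → Independent G S × ∣ S ∣ ≡ a)
  × (∀ (S : Subset n) → Independent G S → ∣ S ∣ ℕ.≤ a)

Divisor : ℕ → Set
Divisor n = Fin n → ℤ

deg : {n : ℕ} → Divisor n → ℤ
deg {n} D = sumℤ n D

Effective : {n : ℕ} → Divisor n → Set
Effective D = ∀ v → 0ℤ ℤ.≤ D v

_-ᴰ_ : {n : ℕ} → Divisor n → Divisor n → Divisor n
(D -ᴰ E) v = D v - E v

laplacian : {n : ℕ} → Graph n → (Fin n → ℤ) → Divisor n
laplacian {n} G f v =
  (+ valence G v) * f v - sumℤ n (λ u → if adj G v u then f u else 0ℤ)

Equiv : {n : ℕ} → Graph n → Divisor n → Divisor n → Set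
Equiv {n} G D D' = Σ (Fin n → ℤ) λ f → ∀ v → (D -ᴰ D') v ≡ laplacian G f v

EquivEffective : {n : ℕ} → Graph n → Divisor n → Set
EquivEffective G D = Σ (Divisor _) λ F → Effective F × Equiv G D F

RankAtLeast : {n : ℕ} → Graph n → Divisor n → ℕ → Set
RankAtLeast G D r =
  EquivEffective G D
  × (∀ E → Effective E → deg E ≡ + r → EquivEffective G (D -ᴰ E))

PositiveRank : {n : ℕ} → Graph n → Divisor n → Set
PositiveRank G D = ∃[ r ] (1 ℕ.≤ r × RankAtLeast G D r)

IsGonality : {n : ℕ} → Graph n → ℕ → Set
IsGonality G k =
  (Σ (Divisor _) λ D → PositiveRank G D × deg D ≡ + k)
  × (∀ D → PositiveRank G D → + k ℤ.≤ deg D)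

MultFree : {n : ℕ} → Divisor n → Set
MultFree D = Effective D × (∀ v → D v ℤ.≤ + 1)

IsMFGonality : {n : ℕ} → Graph n → ℕ → Set
IsMFGonality G k =
  (Σ (Divisor _) λ D → MultFree D × PositiveRank G D × deg D ≡ + k)
  × (∀ D → MultFree D → PositiveRank G D → + k ℤ.≤ deg D)

-- Upper bound: for a maximum independent set S, the divisor with one chip on every vertex outside S
-- has positive rank, because a chip can be brought to any w ∈ S by letting all neighbours of w
-- (which lie outside S) fire one chip towards w.
--
-- Lower bound: let D be effective of positive rank and of degree k < n − α, and let Z be its set of
-- chip-free vertices. Take an edge xy inside Z and f with D − Lf effective and positive at x. Some
-- neighbour z of x or y has f(z) > f(x), f(y), and the superlevel set S = {f ≥ f(z)} misses x and y.
-- If |S| ≥ 2, summing Lf over S counts every edge leaving S at least once, and since δ > n/2 such a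
-- cut has at least n − 1 edges, so k ≥ n − 1. If S = {z}, then z is a strict local maximum of f and
-- D(z) ≥ Lf(z) ≥ val(z). Both are impossible once Z is large. If no vertex w has D(w) ≥ val(w),
-- then |Z| ≥ n − k > α yields the edge. Otherwise (Z ∖ N(w)) ∪ {w} still has more than α vertices,
-- and the vertex z found, being adjacent to x or y, differs from w, so k ≥ D(z) + D(w) ≥ 2δ > n.

module Submission where

module Gonality where
  open import Data.Bool using (Bool; true; false; not; _∧_; _∨_; if_then_else_)
  import Data.Bool.Properties as Bool
  open import Data.Empty using (⊥; ⊥-elim)
  open import Data.Fin using (Fin; zero; suc; punchIn; punchOut)
  import Data.Fin as Fin
  open import Data.Fin.Properties using (any?; punchInᵢ≢i; punchIn-punchOut)
  open import Data.Fin.Subset using (Subset; ∣_∣; ⁅_⁆) renaming (_∈_ to _∈ₛ_)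
  open import Data.Fin.Subset.Properties using (∣p∣≤n; ∣⁅x⁆∣≡1; x∈⁅y⁆⇒x≡y)
  open import Data.Integer using (ℤ; +_; -[1+_]; 0ℤ; 1ℤ; -1ℤ; _+_; _-_; _*_; -_; _≤_; _<_; _≤?_; _<?_; +≤+; -≤+; +<+)
  open import Data.Integer.Properties
  open import Algebra.Properties.Semiring.Sum +-*-semiring
    using (sum; sum-cong-≗; sum-replicate-zero; sum-remove; ∑-distrib-+; ∑-comm; *-distribˡ-sum; *-distribʳ-sum)
  open import Data.Integer.Tactic.RingSolver using (solve-∀)
  import Data.Nat as ℕ
  import Data.Nat.Properties as ℕP
  open import Data.Product using (Σ; ∃; _×_; _,_; proj₁; proj₂)
  open import Data.Sum using (_⊎_; inj₁; inj₂; [_,_]′)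
  open import Data.Vec using (lookup; tabulate; []; _∷_)
  open import Data.Vec.Properties using (lookup∘tabulate; []=⇒lookup; lookup⇒[]=)
  open import Defs hiding (sym)
  open import Function using (_∘_)
  open import Relation.Binary.PropositionalEquality
  open import Relation.Nullary using (¬_; yes; no; does; Dec)
  open import Relation.Nullary.Decidable using (_×-dec_; ¬?; dec-true; dec-false)

  sumℤ≡sum : ∀ n (f : Fin n → ℤ) → sumℤ n f ≡ sum f
  sumℤ≡sum ℕ.zero    f = refl
  sumℤ≡sum (ℕ.suc n) f = cong (_+_ (f zero)) (sumℤ≡sum n (f ∘ suc))

  sum-zero : ∀ {n} {f : Fin n → ℤ} → (∀ i → f i ≡ 0ℤ) → sum f ≡ 0ℤ
  sum-zero {n} f≡0 = trans (sum-cong-≗ f≡0) (sum-replicate-zero n)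

  sum-neg : ∀ {n} (f : Fin n → ℤ) → sum (-_ ∘ f) ≡ - sum f
  sum-neg f = begin
    sum (-_ ∘ f)        ≡⟨ sum-cong-≗ (sym ∘ -1*i≡-i ∘ f) ⟩
    sum ((-1ℤ *_) ∘ f)  ≡⟨ sym (*-distribˡ-sum -1ℤ f) ⟩
    -1ℤ * sum f         ≡⟨ -1*i≡-i (sum f) ⟩
    - sum f             ∎
    where open ≡-Reasoning

  ∑-distrib-minus : ∀ {n} (f g : Fin n → ℤ) → sum (λ i → f i - g i) ≡ sum f - sum g
  ∑-distrib-minus f g = trans (∑-distrib-+ f (-_ ∘ g)) (cong (_+_ (sum f)) (sum-neg g))

  sum-mono : ∀ {n} {f g : Fin n → ℤ} → (∀ i → f i ≤ g i) → sum f ≤ sum g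
  sum-mono {ℕ.zero}  _   = ≤-refl
  sum-mono {ℕ.suc n} f≤g = +-mono-≤ (f≤g zero) (sum-mono (f≤g ∘ suc))

  sum-nonneg : ∀ {n} {f : Fin n → ℤ} → (∀ i → 0ℤ ≤ f i) → 0ℤ ≤ sum f
  sum-nonneg {n} 0≤f = ≤-trans (≤-reflexive (sym (sum-replicate-zero n))) (sum-mono 0≤f)

  sum-point : ∀ {n} (f : Fin n → ℤ) w → (∀ v → v ≢ w → f v ≡ 0ℤ) → sum f ≡ f w
  sum-point {ℕ.suc n} f w f≡0 = begin
    sum f                            ≡⟨ sum-remove {i = w} f ⟩
    f w + sum (f ∘ punchIn w)        ≡⟨ cong (_+_ (f w)) (sum-zero (λ j → f≡0 _ (punchInᵢ≢i w j))) ⟩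
    f w + 0ℤ                         ≡⟨ +-identityʳ (f w) ⟩
    f w                              ∎
    where open ≡-Reasoning

  term≤sum : ∀ {n} {f : Fin n → ℤ} → (∀ i → 0ℤ ≤ f i) → ∀ w → f w ≤ sum f
  term≤sum {ℕ.suc n} {f} 0≤f w = begin
    f w                        ≡⟨ sym (+-identityʳ (f w)) ⟩
    f w + 0ℤ                   ≤⟨ +-monoʳ-≤ (f w) (sum-nonneg (0≤f ∘ punchIn w)) ⟩
    f w + sum (f ∘ punchIn w)  ≡⟨ sym (sum-remove {i = w} f) ⟩
    sum f                      ∎
    where open ≤-Reasoning

  two-terms≤sum : ∀ {n} {f : Fin n → ℤ} → (∀ i → 0ℤ ≤ f i) → ∀ {a b} → a ≢ b → f a + f b ≤ sum f
  two-terms≤sum {ℕ.suc n} {f} 0≤f {a} {b} a≢b = begin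
    f a + f b                            ≡⟨ cong (λ v → f a + f v) (sym (punchIn-punchOut a≢b)) ⟩
    f a + f (punchIn a (punchOut a≢b))   ≤⟨ +-monoʳ-≤ (f a) (term≤sum (0≤f ∘ punchIn a) (punchOut a≢b)) ⟩
    f a + sum (f ∘ punchIn a)            ≡⟨ sym (sum-remove {i = a} f) ⟩
    sum f                                ∎
    where open ≤-Reasoning

  nonneg-sum≡0 : ∀ {n} {f : Fin n → ℤ} → (∀ i → 0ℤ ≤ f i) → sum f ≡ 0ℤ → ∀ i → f i ≡ 0ℤ
  nonneg-sum≡0 0≤f Σf≡0 i = ≤-antisym (≤-trans (term≤sum 0≤f i) (≤-reflexive Σf≡0)) (0≤f i)

  sum-ones : ∀ n → sum {n} (λ _ → 1ℤ) ≡ + n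
  sum-ones ℕ.zero    = refl
  sum-ones (ℕ.suc n) = cong (_+_ 1ℤ) (sum-ones n)

  when : Bool → ℤ → ℤ
  when b x = if b then x else 0ℤ

  𝟙 : Bool → ℤ
  𝟙 b = when b 1ℤ

  when-nonneg : ∀ b {x} → 0ℤ ≤ x → 0ℤ ≤ when b x
  when-nonneg true  0≤x = 0≤x
  when-nonneg false _   = ≤-refl

  𝟙-nonneg : ∀ b → 0ℤ ≤ 𝟙 b
  𝟙-nonneg b = when-nonneg b (+≤+ ℕ.z≤n)

  when-0 : ∀ b → when b 0ℤ ≡ 0ℤ
  when-0 true  = refl
  when-0 false = refl

  when-minus : ∀ b x y → when b x - when b y ≡ when b (x - y)
  when-minus true  x y = refl
  when-minus false x y = refl

  when-sum : ∀ b {n} (g : Fin n → ℤ) → when b (sum g) ≡ sum (when b ∘ g)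
  when-sum true  g = refl
  when-sum false {n} g = sym (sum-zero {n} (λ _ → refl))

  𝟙*≡when : ∀ b x → 𝟙 b * x ≡ when b x
  𝟙*≡when true  x = *-identityˡ x
  𝟙*≡when false x = refl

  card : ∀ {n} → (Fin n → Bool) → ℤ
  card P = sum (𝟙 ∘ P)

  card*≡sum-when : ∀ {n} (P : Fin n → Bool) x → card P * x ≡ sum (λ u → when (P u) x)
  card*≡sum-when P x = trans (*-distribʳ-sum x (𝟙 ∘ P)) (sum-cong-≗ (λ u → 𝟙*≡when (P u) x))

  card-∁ : ∀ {n} (P : Fin n → Bool) → card P + card (not ∘ P) ≡ + n
  card-∁ {n} P = begin
    card P + card (not ∘ P)                ≡⟨ sym (∑-distrib-+ (𝟙 ∘ P) (𝟙 ∘ not ∘ P)) ⟩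
    sum (λ v → 𝟙 (P v) + 𝟙 (not (P v)))    ≡⟨ sum-cong-≗ (λ v → 𝟙+𝟙∘not (P v)) ⟩
    sum {n} (λ _ → 1ℤ)                     ≡⟨ sum-ones n ⟩
    + n                                    ∎
    where
    open ≡-Reasoning
    𝟙+𝟙∘not : ∀ b → 𝟙 b + 𝟙 (not b) ≡ 1ℤ
    𝟙+𝟙∘not true  = refl
    𝟙+𝟙∘not false = refl

  card≥2 : ∀ {n} {P : Fin n → Bool} {a b} → P a ≡ true → P b ≡ true → a ≢ b → + 2 ≤ card P
  card≥2 {P = P} {a} {b} Pa Pb a≢b = begin
    + 2                  ≡⟨ cong₂ (λ p q → 𝟙 p + 𝟙 q) (sym Pa) (sym Pb) ⟩
    𝟙 (P a) + 𝟙 (P b)    ≤⟨ two-terms≤sum (𝟙-nonneg ∘ P) a≢b ⟩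
    card P               ∎
    where open ≤-Reasoning

  countTrue≡card : ∀ {n} (P : Fin n → Bool) → + countTrue n P ≡ card P
  countTrue≡card {ℕ.zero}  P = refl
  countTrue≡card {ℕ.suc n} P =
    trans (pos-+ (if P zero then 1 else 0) _) (cong₂ _+_ (if≡𝟙 (P zero)) (countTrue≡card (P ∘ suc)))
    where
    if≡𝟙 : ∀ b → + (if b then 1 else 0) ≡ 𝟙 b
    if≡𝟙 true  = refl
    if≡𝟙 false = refl

  card-lookup : ∀ {n} (S : Subset n) → + ∣ S ∣ ≡ card (lookup S)
  card-lookup []          = refl
  card-lookup (true ∷ S)  = trans (pos-+ 1 ∣ S ∣) (cong (_+_ 1ℤ) (card-lookup S))
  card-lookup (false ∷ S) = trans (card-lookup S) (sym (+-identityˡ _))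

  χ : ∀ {n} → Fin n → Fin n → ℤ
  χ w v = 𝟙 (does (v Fin.≟ w))

  χ-diag : ∀ {n} (w : Fin n) → χ w w ≡ 1ℤ
  χ-diag w = cong 𝟙 (dec-true (w Fin.≟ w) refl)

  χ-off : ∀ {n} {w v : Fin n} → v ≢ w → χ w v ≡ 0ℤ
  χ-off {w = w} {v} v≢w = cong 𝟙 (dec-false (v Fin.≟ w) v≢w)

  χ-nonneg : ∀ {n} (w v : Fin n) → 0ℤ ≤ χ w v
  χ-nonneg w v = 𝟙-nonneg _

  sum-χ* : ∀ {n} (w : Fin n) (f : Fin n → ℤ) → sum (λ v → χ w v * f v) ≡ f w
  sum-χ* w f = trans (sum-point _ w (λ v v≢w → cong (_* f v) (χ-off v≢w)))
                     (trans (cong (_* f w) (χ-diag w)) (*-identityˡ (f w)))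

  sum-χ : ∀ {n} (w : Fin n) → sum (χ w) ≡ 1ℤ
  sum-χ w = trans (sum-cong-≗ (λ v → sym (*-identityʳ (χ w v)))) (sum-χ* w (λ _ → 1ℤ))

  <⇒1≤- : ∀ {i j} → i < j → 1ℤ ≤ j - i
  <⇒1≤- {i} {j} i<j = ≤-trans (≤-reflexive (sym (cancel i))) (+-monoˡ-≤ (- i) (i<j⇒suc[i]≤j i<j))
    where
    cancel : ∀ i → (1ℤ + i) - i ≡ 1ℤ
    cancel = solve-∀

  1≤-⇒< : ∀ {i j} → 1ℤ ≤ j - i → i < j
  1≤-⇒< {i} {j} 1≤j-i = suc[i]≤j⇒i<j (≤-trans (+-monoˡ-≤ i 1≤j-i) (≤-reflexive (cancel j i)))
    where
    cancel : ∀ j i → (j - i) + i ≡ j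
    cancel = solve-∀

  0≤* : ∀ i j → 0ℤ ≤ i → 0ℤ ≤ j → 0ℤ ≤ i * j
  0≤* (+ m) (+ k) _ _ = ≤-trans (+≤+ ℕ.z≤n) (≤-reflexive (pos-* m k))

  true≢false : true ≢ false
  true≢false ()

  adj⇒≢ : ∀ {n} (G : Graph n) {u v} → adj G u v ≡ true → u ≢ v
  adj⇒≢ G {u} u~v refl = true≢false (trans (sym u~v) (irrefl G u))

  laplacian-as-sum : ∀ {n} (G : Graph n) (f : Fin n → ℤ) v →
    laplacian G f v ≡ sum (λ u → when (adj G v u) (f v - f u))
  laplacian-as-sum {n} G f v = begin
    + valence G v * f v - sumℤ n (λ u → when (adj G v u) (f u))
      ≡⟨ cong₂ (λ c s → c * f v - s) (countTrue≡card (adj G v)) (sumℤ≡sum n _) ⟩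
    card (adj G v) * f v - sum (λ u → when (adj G v u) (f u))
      ≡⟨ cong (_- sum (λ u → when (adj G v u) (f u))) (card*≡sum-when (adj G v) (f v)) ⟩
    sum (λ u → when (adj G v u) (f v)) - sum (λ u → when (adj G v u) (f u))
      ≡⟨ sym (∑-distrib-minus (λ u → when (adj G v u) (f v)) (λ u → when (adj G v u) (f u))) ⟩
    sum (λ u → when (adj G v u) (f v) - when (adj G v u) (f u))
      ≡⟨ sum-cong-≗ (λ u → when-minus (adj G v u) (f v) (f u)) ⟩
    sum (λ u → when (adj G v u) (f v - f u))
      ∎
    where open ≡-Reasoning

  laplacian-minus : ∀ {n} (G : Graph n) (f g : Fin n → ℤ) v →
    laplacian G (λ u → f u - g u) v ≡ laplacian G f v - laplacian G g v
  laplacian-minus G f g v = begin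
    laplacian G (λ u → f u - g u) v
      ≡⟨ laplacian-as-sum G _ v ⟩
    sum (λ u → when (adj G v u) ((f v - g v) - (f u - g u)))
      ≡⟨ sum-cong-≗ (λ u → cong (when (adj G v u)) (interchange (f v) (g v) (f u) (g u))) ⟩
    sum (λ u → when (adj G v u) ((f v - f u) - (g v - g u)))
      ≡⟨ sum-cong-≗ (λ u → sym (when-minus (adj G v u) _ _)) ⟩
    sum (λ u → when (adj G v u) (f v - f u) - when (adj G v u) (g v - g u))
      ≡⟨ ∑-distrib-minus (λ u → when (adj G v u) (f v - f u)) (λ u → when (adj G v u) (g v - g u)) ⟩
    sum (λ u → when (adj G v u) (f v - f u)) - sum (λ u → when (adj G v u) (g v - g u))
      ≡⟨ sym (cong₂ _-_ (laplacian-as-sum G f v) (laplacian-as-sum G g v)) ⟩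
    laplacian G f v - laplacian G g v
      ∎
    where
    open ≡-Reasoning
    interchange : ∀ a b c d → (a - b) - (c - d) ≡ (a - c) - (b - d)
    interchange = solve-∀

  laplacian-zero : ∀ {n} (G : Graph n) v → laplacian G (λ _ → 0ℤ) v ≡ 0ℤ
  laplacian-zero G v = trans (laplacian-as-sum G _ v) (sum-zero (λ u → when-0 (adj G v u)))

  laplacian-χ : ∀ {n} (G : Graph n) w v → laplacian G (χ w) v ≡ + valence G v * χ w v - 𝟙 (adj G v w)
  laplacian-χ {n} G w v = cong (_-_ (+ valence G v * χ w v)) (trans (sumℤ≡sum n _)
    (trans (sum-point _ w vanish) (cong (when (adj G v w)) (χ-diag w))))
    where
    vanish : ∀ u → u ≢ w → when (adj G v u) (χ w u) ≡ 0ℤ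
    vanish u u≢w = trans (cong (when (adj G v u)) (χ-off u≢w)) (when-0 (adj G v u))

  flux : ∀ {n} → Graph n → (Fin n → ℤ) → (Fin n → Bool) → ℤ
  flux G f S = sum λ u → sum λ v → when (S u ∧ not (S v) ∧ adj G u v) (f u - f v)

  i≡-i⇒i≡0 : ∀ {i} → i ≡ - i → i ≡ 0ℤ
  i≡-i⇒i≡0 {+ ℕ.zero}    _  = refl
  i≡-i⇒i≡0 {+ ℕ.suc _}   ()
  i≡-i⇒i≡0 { -[1+ _ ]}   ()

  ∑∑-antisym≡0 : ∀ {n} (A : Fin n → Fin n → ℤ) → (∀ u v → A u v ≡ - A v u) → sum (λ u → sum (A u)) ≡ 0ℤ
  ∑∑-antisym≡0 A antisym = i≡-i⇒i≡0 (begin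
    sum (λ u → sum (A u))            ≡⟨ ∑-comm A ⟩
    sum (λ v → sum (λ u → A u v))    ≡⟨ sum-cong-≗ (λ v → sum-cong-≗ (λ u → antisym u v)) ⟩
    sum (λ v → sum (λ u → - A v u))  ≡⟨ sum-cong-≗ (λ v → sum-neg (A v)) ⟩
    sum (λ v → - sum (A v))          ≡⟨ sum-neg (λ v → sum (A v)) ⟩
    - sum (λ v → sum (A v))          ∎)
    where open ≡-Reasoning

  -- Discrete divergence theorem: the edges inside S contribute opposite amounts at their two ends.
  ∑-laplacian≡flux : ∀ {n} (G : Graph n) (f : Fin n → ℤ) (S : Fin n → Bool) →
    sum (λ u → when (S u) (laplacian G f u)) ≡ flux G f S
  ∑-laplacian≡flux {n} G f S = begin
    sum (λ u → when (S u) (laplacian G f u))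
      ≡⟨ sum-cong-≗ (λ u → trans (cong (when (S u)) (laplacian-as-sum G f u))
                                 (when-sum (S u) (λ v → when (adj G u v) (f u - f v)))) ⟩
    sum (λ u → sum (λ v → when (S u) (when (adj G u v) (f u - f v))))
      ≡⟨ sum-cong-≗ (λ u → sum-cong-≗ (λ v → split (S u) (S v) (adj G u v) (f u - f v))) ⟩
    sum (λ u → sum (λ v → inner u v + crossing u v))
      ≡⟨ sum-cong-≗ (λ u → ∑-distrib-+ (inner u) (crossing u)) ⟩
    sum (λ u → sum (inner u) + sum (crossing u))
      ≡⟨ ∑-distrib-+ (λ u → sum (inner u)) (λ u → sum (crossing u)) ⟩
    sum (λ u → sum (inner u)) + flux G f S
      ≡⟨ cong (_+ flux G f S) (∑∑-antisym≡0 inner inner-antisym) ⟩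
    0ℤ + flux G f S
      ≡⟨ +-identityˡ _ ⟩
    flux G f S
      ∎
    where
    open ≡-Reasoning
    inner crossing : Fin n → Fin n → ℤ
    inner    u v = when (S u ∧ S v ∧ adj G u v) (f u - f v)
    crossing u v = when (S u ∧ not (S v) ∧ adj G u v) (f u - f v)
    split : ∀ s t a d → when s (when a d) ≡ when (s ∧ t ∧ a) d + when (s ∧ not t ∧ a) d
    split false t     a     d = refl
    split true  true  true  d = sym (+-identityʳ d)
    split true  true  false d = refl
    split true  false true  d = sym (+-identityˡ d)
    split true  false false d = refl
    flip-minus : ∀ x y → x - y ≡ - (y - x)
    flip-minus = solve-∀
    inner-antisym : ∀ u v → inner u v ≡ - inner v u
    inner-antisym u v rewrite Graph.sym G v u with S u | S v | adj G u v
    ... | true  | true  | true  = flip-minus (f u) (f v)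
    ... | true  | true  | false = refl
    ... | true  | false | _     = refl
    ... | false | true  | _     = refl
    ... | false | false | _     = refl

  ∑-laplacian≡0 : ∀ {n} (G : Graph n) (f : Fin n → ℤ) → sum (laplacian G f) ≡ 0ℤ
  ∑-laplacian≡0 {n} G f = trans (∑-laplacian≡flux G f (λ _ → true)) (sum-zero {n} (λ _ → sum-zero {n} (λ _ → refl)))

  equiv⇒deg≡ : ∀ {n} (G : Graph n) {D D′ : Divisor n} → Equiv G D D′ → deg D ≡ deg D′
  equiv⇒deg≡ {n} G {D} {D′} (f , D-D′≡Lf) = i-j≡0⇒i≡j _ _ (begin
    deg D - deg D′        ≡⟨ cong₂ _-_ (sumℤ≡sum n D) (sumℤ≡sum n D′) ⟩
    sum D - sum D′        ≡⟨ sym (∑-distrib-minus D D′) ⟩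
    sum (D -ᴰ D′)         ≡⟨ sum-cong-≗ D-D′≡Lf ⟩
    sum (laplacian G f)   ≡⟨ ∑-laplacian≡0 G f ⟩
    0ℤ                    ∎)
    where open ≡-Reasoning

  firing⇒equivEffective : ∀ {n} (G : Graph n) (D : Divisor n) f →
    Effective (D -ᴰ laplacian G f) → EquivEffective G D
  firing⇒equivEffective G D f eff = D -ᴰ laplacian G f , eff , f , λ v → cancel (D v) (laplacian G f v)
    where
    cancel : ∀ x y → x - (x - y) ≡ y
    cancel = solve-∀

  fire-difference : ∀ {n} (G : Graph n) (D D₀ E F : Divisor n) {g h} →
    (∀ v → D v - D₀ v ≡ laplacian G g v) → (∀ v → (D v - E v) - F v ≡ laplacian G h v) →
    ∀ v → D₀ v - laplacian G (λ u → h u - g u) v ≡ F v + E v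
  fire-difference G D D₀ E F {g} {h} D-D₀≡Lg D-E-F≡Lh v = begin
    D₀ v - laplacian G (λ u → h u - g u) v
      ≡⟨ cong (_-_ (D₀ v)) (laplacian-minus G h g v) ⟩
    D₀ v - (laplacian G h v - laplacian G g v)
      ≡⟨ cong (_-_ (D₀ v)) (sym (cong₂ _-_ (D-E-F≡Lh v) (D-D₀≡Lg v))) ⟩
    D₀ v - (((D v - E v) - F v) - (D v - D₀ v))
      ≡⟨ rearrange (D₀ v) (D v) (E v) (F v) ⟩
    F v + E v
      ∎
    where
    open ≡-Reasoning
    rearrange : ∀ d₀ d e f → d₀ - (((d - e) - f) - (d - d₀)) ≡ f + e
    rearrange = solve-∀

  -- D − Lf is equivalent to D, so this says that a chip can be moved onto x.
  Reaches : ∀ {n} → Graph n → Divisor n → Fin n → Set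
  Reaches {n} G D x = Σ (Fin n → ℤ) λ f → Effective (D -ᴰ laplacian G f) × 1ℤ ≤ (D -ᴰ laplacian G f) x

  ReachingRepresentative : ∀ {n} → Graph n → Divisor n → Set
  ReachingRepresentative {n} G D = Σ (Divisor n) λ D₀ → Effective D₀ × deg D₀ ≡ deg D × (∀ x → Reaches G D₀ x)

  positiveRank⇒reaching-representative : ∀ {n} (G : Graph n) {D : Divisor n} → PositiveRank G D →
    ReachingRepresentative G D
  positiveRank⇒reaching-representative {n} G {D} (r , 1≤r , (D₀ , D₀-eff , D~D₀@(g , D-D₀≡Lg)) , rank) =
    D₀ , D₀-eff , sym (equiv⇒deg≡ G D~D₀) , reach
    where
    reach : ∀ x → Reaches G D₀ x
    reach x = fire-back (rank E E-eff E-deg)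
      where
      E : Divisor n
      E v = + r * χ x v
      E-eff : Effective E
      E-eff v = 0≤* (+ r) (χ x v) (+≤+ ℕ.z≤n) (χ-nonneg x v)
      E-deg : deg E ≡ + r
      E-deg = trans (sumℤ≡sum n E) (trans (sym (*-distribˡ-sum (+ r) (χ x)))
                (trans (cong (+ r *_) (sum-χ x)) (*-identityʳ (+ r))))
      fire-back : EquivEffective G (D -ᴰ E) → Reaches G D₀ x
      fire-back (F , F-eff , h , D-E-F≡Lh) = (λ u → h u - g u) , F+E-eff , 1≤F+E
        where
        D₀-fired : ∀ v → D₀ v - laplacian G (λ u → h u - g u) v ≡ F v + E v
        D₀-fired = fire-difference G D D₀ E F D-D₀≡Lg D-E-F≡Lh
        F+E-eff : Effective (D₀ -ᴰ laplacian G (λ u → h u - g u))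
        F+E-eff v = ≤-trans (+-mono-≤ (F-eff v) (E-eff v)) (≤-reflexive (sym (D₀-fired v)))
        1≤F+E : 1ℤ ≤ D₀ x - laplacian G (λ u → h u - g u) x
        1≤F+E = begin
          1ℤ              ≤⟨ +≤+ 1≤r ⟩
          + r             ≡⟨ sym (trans (cong (+ r *_) (χ-diag x)) (*-identityʳ (+ r))) ⟩
          E x             ≡⟨ sym (+-identityˡ (E x)) ⟩
          0ℤ + E x        ≤⟨ +-monoˡ-≤ (E x) (F-eff x) ⟩
          F x + E x       ≡⟨ sym (D₀-fired x) ⟩
          D₀ x - laplacian G (λ u → h u - g u) x ∎
          where open ≤-Reasoning

  complementDivisor : ∀ {n} → Subset n → Divisor n
  complementDivisor S v = 𝟙 (not (lookup S v))

  complementDivisor-multFree : ∀ {n} (S : Subset n) → MultFree (complementDivisor S)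
  complementDivisor-multFree S = (λ v → 𝟙-nonneg _) , λ v → 𝟙≤1 (not (lookup S v))
    where
    𝟙≤1 : ∀ b → 𝟙 b ≤ + 1
    𝟙≤1 true  = ≤-refl
    𝟙≤1 false = +≤+ ℕ.z≤n

  pos-∸ : ∀ {m n} → m ℕ.≤ n → + (n ℕ.∸ m) ≡ + n - + m
  pos-∸ {m} {n} m≤n = sym (trans (m-n≡m⊖n n m) (≤-⊖ m≤n))

  complementDivisor-deg : ∀ {n} (S : Subset n) → deg (complementDivisor S) ≡ + (n ℕ.∸ ∣ S ∣)
  complementDivisor-deg {n} S = begin
    deg (complementDivisor S)                ≡⟨ sumℤ≡sum n (complementDivisor S) ⟩
    card (not ∘ lookup S)                    ≡⟨ sym (cancel (card (lookup S)) (card (not ∘ lookup S))) ⟩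
    (card (lookup S) + card (not ∘ lookup S)) - card (lookup S)
                                             ≡⟨ cong₂ _-_ (card-∁ (lookup S)) (sym (card-lookup S)) ⟩
    + n - + ∣ S ∣                            ≡⟨ sym (pos-∸ (∣p∣≤n S)) ⟩
    + (n ℕ.∸ ∣ S ∣)                          ∎
    where
    open ≡-Reasoning
    cancel : ∀ a b → (a + b) - a ≡ b
    cancel = solve-∀

  degree-one⇒point : ∀ {n} (E : Fin n → ℤ) → (∀ v → 0ℤ ≤ E v) → sum E ≡ 1ℤ →
    Σ (Fin n) λ w → ∀ v → E v ≡ χ w v
  degree-one⇒point {ℕ.zero}  E _   ()
  degree-one⇒point {ℕ.suc n} E E≥0 ΣE≡1 with E zero ≟ 0ℤ
  ... | yes E₀≡0 with degree-one⇒point (E ∘ suc) (E≥0 ∘ suc)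
                 (trans (sym (+-identityˡ _)) (trans (cong (_+ sum (E ∘ suc)) (sym E₀≡0)) ΣE≡1))
  ...   | w , rest≡χ = suc w , λ { zero → E₀≡0 ; (suc v) → rest≡χ v }
  degree-one⇒point {ℕ.suc n} E E≥0 ΣE≡1 | no E₀≢0 = zero , λ { zero → E₀≡1 ; (suc v) → rest≡0 v }
    where
    1≤E₀ : 1ℤ ≤ E zero
    1≤E₀ = i<j⇒suc[i]≤j (≤∧≢⇒< (E≥0 zero) (E₀≢0 ∘ sym))
    E₀≤1 : E zero ≤ 1ℤ
    E₀≤1 = ≤-trans (≤-trans (≤-reflexive (sym (+-identityʳ (E zero))))
             (+-monoʳ-≤ (E zero) (sum-nonneg (E≥0 ∘ suc)))) (≤-reflexive ΣE≡1)
    E₀≡1 : E zero ≡ 1ℤ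
    E₀≡1 = ≤-antisym E₀≤1 1≤E₀
    rest≡0 : ∀ v → E (suc v) ≡ 0ℤ
    rest≡0 = nonneg-sum≡0 (E≥0 ∘ suc) (trans (cancel (E zero) _) (cong₂ _-_ ΣE≡1 E₀≡1))
      where
      cancel : ∀ a b → b ≡ (a + b) - a
      cancel = solve-∀

  effective⇒equivEffective : ∀ {n} (G : Graph n) (D : Divisor n) → Effective D → EquivEffective G D
  effective⇒equivEffective G D D-eff =
    D , D-eff , (λ _ → 0ℤ) , λ v → trans (+-inverseʳ (D v)) (sym (laplacian-zero G v))

  equivEffective-cong : ∀ {n} (G : Graph n) {D D′ : Divisor n} → (∀ v → D v ≡ D′ v) →
    EquivEffective G D → EquivEffective G D′
  equivEffective-cong G D≗D′ (F , F-eff , f , D-F≡Lf) =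
    F , F-eff , f , λ v → trans (cong (λ d → d - F v) (sym (D≗D′ v))) (D-F≡Lf v)

  laplacian-neg-χ : ∀ {n} (G : Graph n) w v →
    laplacian G (λ u → 0ℤ - χ w u) v ≡ 𝟙 (adj G v w) - + valence G v * χ w v
  laplacian-neg-χ G w v = begin
    laplacian G (λ u → 0ℤ - χ w u) v                        ≡⟨ laplacian-minus G (λ _ → 0ℤ) (χ w) v ⟩
    laplacian G (λ _ → 0ℤ) v - laplacian G (χ w) v          ≡⟨ cong₂ _-_ (laplacian-zero G v) (laplacian-χ G w v) ⟩
    0ℤ - (+ valence G v * χ w v - 𝟙 (adj G v w))            ≡⟨ negate (+ valence G v * χ w v) (𝟙 (adj G v w)) ⟩
    𝟙 (adj G v w) - + valence G v * χ w v                   ∎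
    where
    open ≡-Reasoning
    negate : ∀ p a → 0ℤ - (p - a) ≡ a - p
    negate = solve-∀

  complementDivisor-minus-outside : ∀ {n} (S : Subset n) {w} → lookup S w ≡ false →
    Effective (complementDivisor S -ᴰ χ w)
  complementDivisor-minus-outside S {w} w∉S v = i≤j⇒0≤j-i (χ≤D v)
    where
    χ≤D : ∀ v → χ w v ≤ complementDivisor S v
    χ≤D v with v Fin.≟ w
    ... | yes refl = ≤-reflexive (cong (𝟙 ∘ not) (sym w∉S))
    ... | no _     = 𝟙-nonneg _

  independent⇒neighbour-outside : ∀ {n} (G : Graph n) {S : Subset n} → Independent G S →
    ∀ {w} → lookup S w ≡ true → ∀ v → 𝟙 (adj G v w) ≤ complementDivisor S v
  independent⇒neighbour-outside G {S} S-indep {w} w∈S v with adj G v w in v~w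
  ... | false = 𝟙-nonneg _
  ... | true with lookup S v in v∈?S
  ...   | false = ≤-refl
  ...   | true  = ⊥-elim (true≢false (trans (sym v~w)
                    (S-indep v w (lookup⇒[]= v S v∈?S) (lookup⇒[]= w S w∈S))))

  -- Every neighbour of w lies outside S, so letting them all fire towards w keeps the divisor effective.
  complementDivisor-fire-towards : ∀ {n} (G : Graph n) {S : Subset n} → Independent G S →
    (∀ v → 1 ℕ.≤ valence G v) → ∀ {w} → lookup S w ≡ true →
    Effective ((complementDivisor S -ᴰ χ w) -ᴰ laplacian G (λ u → 0ℤ - χ w u))
  complementDivisor-fire-towards G {S} S-indep val≥1 {w} w∈S v =
    ≤-trans (i≤j⇒0≤j-i (lost≤gained v)) (≤-reflexive (sym fired))
    where
    D = complementDivisor S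
    rearrange : ∀ d c a p → (d - c) - (a - p) ≡ (d + p) - (c + a)
    rearrange = solve-∀
    fired : (D v - χ w v) - laplacian G (λ u → 0ℤ - χ w u) v ≡
            (D v + + valence G v * χ w v) - (χ w v + 𝟙 (adj G v w))
    fired = trans (cong (_-_ (D v - χ w v)) (laplacian-neg-χ G w v))
                  (rearrange (D v) (χ w v) (𝟙 (adj G v w)) (+ valence G v * χ w v))
    lost≤gained : ∀ v → χ w v + 𝟙 (adj G v w) ≤ D v + + valence G v * χ w v
    lost≤gained v with v Fin.≟ w
    ... | yes refl = begin
      1ℤ + 𝟙 (adj G w w)          ≡⟨ cong (λ b → 1ℤ + 𝟙 b) (irrefl G w) ⟩
      1ℤ                          ≤⟨ +≤+ (val≥1 w) ⟩
      + valence G w               ≡⟨ sym (*-identityʳ _) ⟩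
      + valence G w * 1ℤ          ≡⟨ sym (+-identityˡ _) ⟩
      0ℤ + + valence G w * 1ℤ     ≡⟨ cong (λ c → 𝟙 (not c) + + valence G w * 1ℤ) (sym w∈S) ⟩
      D w + + valence G w * 1ℤ    ∎
      where open ≤-Reasoning
    ... | no _ = begin
      0ℤ + 𝟙 (adj G v w)          ≡⟨ +-identityˡ _ ⟩
      𝟙 (adj G v w)               ≤⟨ independent⇒neighbour-outside G S-indep w∈S v ⟩
      D v                         ≡⟨ sym (+-identityʳ (D v)) ⟩
      D v + 0ℤ                    ≡⟨ cong (_+_ (D v)) (sym (*-zeroʳ (+ valence G v))) ⟩
      D v + + valence G v * 0ℤ    ∎
      where open ≤-Reasoning

  complementDivisor-minus-point : ∀ {n} (G : Graph n) {S : Subset n} → Independent G S →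
    (∀ v → 1 ℕ.≤ valence G v) → ∀ w → EquivEffective G (complementDivisor S -ᴰ χ w)
  complementDivisor-minus-point G {S} S-indep val≥1 w with lookup S w in w∈?S
  ... | false = effective⇒equivEffective G (complementDivisor S -ᴰ χ w) (complementDivisor-minus-outside S w∈?S)
  ... | true  = firing⇒equivEffective G (complementDivisor S -ᴰ χ w) (λ u → 0ℤ - χ w u)
                  (complementDivisor-fire-towards G S-indep val≥1 w∈?S)

  complementDivisor-rank≥1 : ∀ {n} (G : Graph n) {S : Subset n} → Independent G S →
    (∀ v → 1 ℕ.≤ valence G v) → RankAtLeast G (complementDivisor S) 1
  complementDivisor-rank≥1 {n} G {S} S-indep val≥1 =
    effective⇒equivEffective G (complementDivisor S) (λ v → 𝟙-nonneg _) , remove-chip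
    where
    remove-chip : ∀ E → Effective E → deg E ≡ + 1 → EquivEffective G (complementDivisor S -ᴰ E)
    remove-chip E E-eff E-deg with degree-one⇒point E E-eff (trans (sym (sumℤ≡sum n E)) E-deg)
    ... | w , E≗χ = equivEffective-cong G (λ v → cong (_-_ (complementDivisor S v)) (sym (E≗χ v)))
                      (complementDivisor-minus-point G S-indep val≥1 w)

  positive-valence : ∀ {n} (G : Graph n) {d} → MinValenceAtLeast G d → n ℕ.< d ℕ.+ d → ∀ v → 1 ℕ.≤ valence G v
  positive-valence G {ℕ.zero}  δ ()
  positive-valence G {ℕ.suc d} δ _  v = ℕP.≤-trans (ℕ.s≤s ℕ.z≤n) (δ v)

  independenceNumber≥1 : ∀ {n} (G : Graph n) {α} → 1 ℕ.≤ n →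
    (∀ S → Independent G S → ∣ S ∣ ℕ.≤ α) → 1 ℕ.≤ α
  independenceNumber≥1 {ℕ.suc n} G {α} _ α-max =
    subst (ℕ._≤ α) (∣⁅x⁆∣≡1 {ℕ.suc n} zero) (α-max ⁅ zero ⁆ singleton)
    where
    singleton : Independent G ⁅ zero ⁆
    singleton u v u∈ v∈ rewrite x∈⁅y⁆⇒x≡y zero u∈ | x∈⁅y⁆⇒x≡y zero v∈ = irrefl G zero

  large-set-has-edge : ∀ {n} (G : Graph n) {α} → (∀ S → Independent G S → ∣ S ∣ ℕ.≤ α) →
    (I : Fin n → Bool) → + α < card I →
    Σ (Fin n) λ x → Σ (Fin n) λ y → I x ≡ true × I y ≡ true × adj G x y ≡ true
  large-set-has-edge G {α} α-max I α<I
    with any? (λ x → any? (λ y → (I x Bool.≟ true) ×-dec ((I y Bool.≟ true) ×-dec (adj G x y Bool.≟ true))))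
  ... | yes (x , y , edge) = x , y , edge
  ... | no no-edge = ⊥-elim (<⇒≱ α<I (begin
    card I                      ≡⟨ sum-cong-≗ (λ v → cong 𝟙 (sym (lookup∘tabulate I v))) ⟩
    card (lookup (tabulate I))  ≡⟨ sym (card-lookup (tabulate I)) ⟩
    + ∣ tabulate I ∣            ≤⟨ +≤+ (α-max (tabulate I) independent) ⟩
    + α                         ∎))
    where
    open ≤-Reasoning
    member : ∀ {u} → u ∈ₛ tabulate I → I u ≡ true
    member {u} u∈ = trans (sym (lookup∘tabulate I u)) ([]=⇒lookup u∈)
    independent : Independent G (tabulate I)
    independent u v u∈ v∈ with adj G u v in u~v
    ... | false = refl
    ... | true  = ⊥-elim (no-edge (u , v , member u∈ , member v∈ , u~v))

  local-max⇒term≤laplacian : ∀ {n} (G : Graph n) (f : Fin n → ℤ) v →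
    (∀ u → adj G v u ≡ true → f u ≤ f v) → ∀ w → when (adj G v w) (f v - f w) ≤ laplacian G f v
  local-max⇒term≤laplacian G f v max w = ≤-trans (term≤sum nonneg w) (≤-reflexive (sym (laplacian-as-sum G f v)))
    where
    nonneg : ∀ u → 0ℤ ≤ when (adj G v u) (f v - f u)
    nonneg u with adj G v u in v~u
    ... | true  = i≤j⇒0≤j-i (max u v~u)
    ... | false = ≤-refl

  local-max⇒laplacian-nonneg : ∀ {n} (G : Graph n) (f : Fin n → ℤ) v →
    (∀ u → adj G v u ≡ true → f u ≤ f v) → 0ℤ ≤ laplacian G f v
  local-max⇒laplacian-nonneg G f v max =
    subst (_≤ laplacian G f v) (cong (λ b → when b (f v - f v)) (irrefl G v)) (local-max⇒term≤laplacian G f v max v)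

  strict-local-max⇒valence≤laplacian : ∀ {n} (G : Graph n) (f : Fin n → ℤ) v →
    (∀ u → adj G v u ≡ true → f u < f v) → + valence G v ≤ laplacian G f v
  strict-local-max⇒valence≤laplacian G f v max = begin
    + valence G v                              ≡⟨ countTrue≡card (adj G v) ⟩
    card (adj G v)                             ≤⟨ sum-mono edge-term ⟩
    sum (λ u → when (adj G v u) (f v - f u))   ≡⟨ sym (laplacian-as-sum G f v) ⟩
    laplacian G f v                            ∎
    where
    open ≤-Reasoning
    edge-term : ∀ u → 𝟙 (adj G v u) ≤ when (adj G v u) (f v - f u)
    edge-term u with adj G v u in v~u
    ... | true  = <⇒1≤- (max u v~u)
    ... | false = ≤-refl

  higher-neighbour? : ∀ {n} (G : Graph n) (f : Fin n → ℤ) v → Dec (∃ λ u → adj G v u ≡ true × f v < f u)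
  higher-neighbour? G f v = any? (λ u → (adj G v u Bool.≟ true) ×-dec (f v <? f u))

  no-higher⇒local-max : ∀ {n} (G : Graph n) (f : Fin n → ℤ) v →
    ¬ (∃ λ u → adj G v u ≡ true × f v < f u) → ∀ u → adj G v u ≡ true → f u ≤ f v
  no-higher⇒local-max G f v none u v~u = ≮⇒≥ (λ fv<fu → none (u , v~u , fv<fu))

  -- Lf(x) < 0 and Lf(y) ≤ 0 forbid the larger of f(x), f(y) from being a local maximum.
  climb : ∀ {n} (G : Graph n) (f : Fin n → ℤ) {x y} →
    laplacian G f x < 0ℤ → laplacian G f y ≤ 0ℤ → adj G x y ≡ true →
    Σ (Fin n) λ z → (adj G x z ≡ true ⊎ adj G y z ≡ true) × f x < f z × f y < f z
  climb G f {x} {y} Lx<0 Ly≤0 x~y with f y ≤? f x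
  ... | yes fy≤fx with higher-neighbour? G f x
  ...   | yes (z , x~z , fx<fz) = z , inj₁ x~z , fx<fz , ≤-<-trans fy≤fx fx<fz
  ...   | no none = ⊥-elim (<⇒≱ Lx<0 (local-max⇒laplacian-nonneg G f x (no-higher⇒local-max G f x none)))
  climb G f {x} {y} Lx<0 Ly≤0 x~y | no fy≰fx with higher-neighbour? G f y
  ...   | yes (z , y~z , fy<fz) = z , inj₂ y~z , <-trans (≰⇒> fy≰fx) fy<fz , fy<fz
  ...   | no none = ⊥-elim (<⇒≱ (suc[i]≤j⇒i<j (≤-trans (<⇒1≤- (≰⇒> fy≰fx)) edge-to-x)) Ly≤0)
    where
    edge-to-x : f y - f x ≤ laplacian G f y
    edge-to-x = subst (λ b → when b (f y - f x) ≤ laplacian G f y) (trans (Graph.sym G y x) x~y)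
                      (local-max⇒term≤laplacian G f y (no-higher⇒local-max G f y none) x)

  superlevel : ∀ {n} → (Fin n → ℤ) → ℤ → Fin n → Bool
  superlevel f t v = does (t ≤? f v)

  superlevel⁺ : ∀ {n} (f : Fin n → ℤ) t v → superlevel f t v ≡ true → t ≤ f v
  superlevel⁺ f t v _ with t ≤? f v
  superlevel⁺ f t v _  | yes t≤fv = t≤fv
  superlevel⁺ f t v () | no _

  superlevel⁻ : ∀ {n} (f : Fin n → ℤ) t v → superlevel f t v ≡ false → f v < t
  superlevel⁻ f t v _ with t ≤? f v
  superlevel⁻ f t v () | yes _
  superlevel⁻ f t v _  | no t≰fv = ≰⇒> t≰fv

  cut : ∀ {n} → Graph n → (Fin n → Bool) → ℤ
  cut G S = sum λ u → sum λ v → 𝟙 (S u ∧ not (S v) ∧ adj G u v)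

  cut-∁ : ∀ {n} (G : Graph n) S → cut G S ≡ cut G (not ∘ S)
  cut-∁ G S = trans (∑-comm (λ u v → 𝟙 (S u ∧ not (S v) ∧ adj G u v)))
                    (sum-cong-≗ λ v → sum-cong-≗ λ u → reverse u v)
    where
    reverse : ∀ u v → 𝟙 (S u ∧ not (S v) ∧ adj G u v) ≡ 𝟙 (not (S v) ∧ not (not (S u)) ∧ adj G v u)
    reverse u v rewrite Graph.sym G v u with S u | S v
    ... | true  | true  = refl
    ... | true  | false = refl
    ... | false | true  = refl
    ... | false | false = refl

  cut≤flux : ∀ {n} (G : Graph n) (f : Fin n → ℤ) S →
    (∀ {u v} → S u ≡ true → S v ≡ false → f v < f u) → cut G S ≤ flux G f S
  cut≤flux G f S descends = sum-mono λ u → sum-mono λ v → crossing u v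
    where
    crossing : ∀ u v → 𝟙 (S u ∧ not (S v) ∧ adj G u v) ≤ when (S u ∧ not (S v) ∧ adj G u v) (f u - f v)
    crossing u v with S u in Su | S v in Sv | adj G u v
    ... | true  | false | true  = <⇒1≤- (descends Su Sv)
    ... | true  | false | false = ≤-refl
    ... | true  | true  | _     = ≤-refl
    ... | false | _     | _     = ≤-refl

  outdegree : ∀ {n} → Graph n → (Fin n → Bool) → Fin n → ℤ
  outdegree G S u = sum λ v → 𝟙 (not (S v) ∧ adj G u v)

  valence+1-card≤outdegree : ∀ {n} (G : Graph n) S {u} → S u ≡ true →
    + valence G u + 1ℤ - card S ≤ outdegree G S u
  valence+1-card≤outdegree G S {u} Su = begin
    + valence G u + 1ℤ - card S
      ≡⟨ cong₂ (λ a b → a + b - card S) (countTrue≡card (adj G u)) (sym (sum-χ u)) ⟩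
    card (adj G u) + sum (χ u) - card S
      ≡⟨ cong (_- card S) (sym (∑-distrib-+ (𝟙 ∘ adj G u) (χ u))) ⟩
    sum (λ v → 𝟙 (adj G u v) + χ u v) - card S
      ≡⟨ sym (∑-distrib-minus (λ v → 𝟙 (adj G u v) + χ u v) (𝟙 ∘ S)) ⟩
    sum (λ v → 𝟙 (adj G u v) + χ u v - 𝟙 (S v))
      ≤⟨ sum-mono count ⟩
    outdegree G S u
      ∎
    where
    open ≤-Reasoning
    count : ∀ v → 𝟙 (adj G u v) + χ u v - 𝟙 (S v) ≤ 𝟙 (not (S v) ∧ adj G u v)
    count v with v Fin.≟ u
    ... | yes refl rewrite Graph.irrefl G u | Su = ≤-refl
    ... | no _ = other (S v) (adj G u v)
      where
      other : ∀ s a → 𝟙 a + 0ℤ - 𝟙 s ≤ 𝟙 (not s ∧ a)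
      other true  true  = ≤-refl
      other true  false = -≤+
      other false true  = ≤-refl
      other false false = ≤-refl

  cut≥ : ∀ {n} (G : Graph n) {d} S → MinValenceAtLeast G d → (+ d + 1ℤ - card S) * card S ≤ cut G S
  cut≥ G {d} S δ = begin
    (+ d + 1ℤ - card S) * card S
      ≡⟨ *-comm (+ d + 1ℤ - card S) (card S) ⟩
    card S * (+ d + 1ℤ - card S)
      ≡⟨ card*≡sum-when S (+ d + 1ℤ - card S) ⟩
    sum (λ u → when (S u) (+ d + 1ℤ - card S))
      ≤⟨ sum-mono enough-outside ⟩
    sum (λ u → when (S u) (outdegree G S u))
      ≡⟨ sum-cong-≗ (λ u → when-sum (S u) (λ v → 𝟙 (not (S v) ∧ adj G u v))) ⟩
    sum (λ u → sum (λ v → when (S u) (𝟙 (not (S v) ∧ adj G u v))))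
      ≡⟨ sum-cong-≗ (λ u → sum-cong-≗ (λ v → when-𝟙 (S u) (not (S v) ∧ adj G u v))) ⟩
    cut G S
      ∎
    where
    open ≤-Reasoning
    when-𝟙 : ∀ s b → when s (𝟙 b) ≡ 𝟙 (s ∧ b)
    when-𝟙 true  b = refl
    when-𝟙 false b = refl
    enough-outside : ∀ u → when (S u) (+ d + 1ℤ - card S) ≤ when (S u) (outdegree G S u)
    enough-outside u with S u in Su
    ... | true  = ≤-trans (+-monoˡ-≤ (- card S) (+-monoˡ-≤ 1ℤ (+≤+ (δ u)))) (valence+1-card≤outdegree G S Su)
    ... | false = ≤-refl

  -- The difference of the two sides is (s − 2)(d − 1 − s).
  2d-2≤[d+1-s]s : ∀ {s d} → + 2 ≤ s → s < d → d + d - + 2 ≤ (d + 1ℤ - s) * s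
  2d-2≤[d+1-s]s {s} {d} 2≤s s<d = 0≤i-j⇒j≤i (subst (0ℤ ≤_) (sym (factor s d))
    (0≤* (s - + 2) (d - (1ℤ + s)) (i≤j⇒0≤j-i 2≤s) (i≤j⇒0≤j-i (i<j⇒suc[i]≤j s<d))))
    where
    factor : ∀ s d → (d + 1ℤ - s) * s - (d + d - + 2) ≡ (s - + 2) * (d - (1ℤ + s))
    factor = solve-∀

  n<d+d⇒ℤ : ∀ {n d} → n ℕ.< d ℕ.+ d → + n < + d + + d
  n<d+d⇒ℤ {n} {d} n<2d = subst (+ n <_) (pos-+ d d) (+<+ n<2d)

  smaller-side-cut : ∀ {n} (G : Graph n) {d} S → MinValenceAtLeast G d → n ℕ.< d ℕ.+ d →
    + 2 ≤ card S → card S + card S ≤ + n → + n - 1ℤ ≤ cut G S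
  smaller-side-cut {n} G {d} S δ n<2d 2≤S 2S≤n = begin
    + n - 1ℤ                       ≤⟨ n-1≤2d-2 ⟩
    + d + + d - + 2                ≤⟨ 2d-2≤[d+1-s]s 2≤S S<d ⟩
    (+ d + 1ℤ - card S) * card S   ≤⟨ cut≥ G S δ ⟩
    cut G S                        ∎
    where
    open ≤-Reasoning
    n<d+d : + n < + d + + d
    n<d+d = n<d+d⇒ℤ {d = d} n<2d
    S<d : card S < + d
    S<d = ≰⇒> (λ d≤S → <⇒≱ n<d+d (≤-trans (+-mono-≤ d≤S d≤S) 2S≤n))
    shift : ∀ m → m - 1ℤ ≡ (1ℤ + m) - + 2
    shift = solve-∀
    n-1≤2d-2 : + n - 1ℤ ≤ + d + + d - + 2
    n-1≤2d-2 = ≤-trans (≤-reflexive (shift (+ n))) (+-monoˡ-≤ (- + 2) (i<j⇒suc[i]≤j n<d+d))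

  edge-cut-bound : ∀ {n} (G : Graph n) {d} S → MinValenceAtLeast G d → n ℕ.< d ℕ.+ d →
    + 2 ≤ card S → + 2 ≤ card (not ∘ S) → + n - 1ℤ ≤ cut G S
  edge-cut-bound G S δ n<2d 2≤S 2≤∁S with ≤-total (card S) (card (not ∘ S))
  ... | inj₁ S≤∁S = smaller-side-cut G S δ n<2d 2≤S
                      (≤-trans (+-monoʳ-≤ (card S) S≤∁S) (≤-reflexive (card-∁ S)))
  ... | inj₂ ∁S≤S = ≤-trans (smaller-side-cut G (not ∘ S) δ n<2d 2≤∁S
                      (≤-trans (+-monoˡ-≤ (card (not ∘ S)) ∁S≤S) (≤-reflexive (card-∁ S))))
                      (≤-reflexive (sym (cut-∁ G S)))

  superlevel-cut⇒deg≥ : ∀ {n} (G : Graph n) {d} {D : Divisor n} (f : Fin n → ℤ) t →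
    MinValenceAtLeast G d → n ℕ.< d ℕ.+ d → Effective D → (∀ v → laplacian G f v ≤ D v) →
    + 2 ≤ card (superlevel f t) → + 2 ≤ card (not ∘ superlevel f t) → + n - 1ℤ ≤ deg D
  superlevel-cut⇒deg≥ {n} G {D = D} f t δ n<2d D-eff Lf≤D 2≤S 2≤∁S = begin
    + n - 1ℤ                                   ≤⟨ edge-cut-bound G S δ n<2d 2≤S 2≤∁S ⟩
    cut G S                                    ≤⟨ cut≤flux G f S descends ⟩
    flux G f S                                 ≡⟨ sym (∑-laplacian≡flux G f S) ⟩
    sum (λ u → when (S u) (laplacian G f u))   ≤⟨ sum-mono (λ u → bounded (S u) u) ⟩
    sum D                                      ≡⟨ sym (sumℤ≡sum n D) ⟩
    deg D                                      ∎
    where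
    open ≤-Reasoning
    S : Fin n → Bool
    S = superlevel f t
    descends : ∀ {u v} → S u ≡ true → S v ≡ false → f v < f u
    descends {u} {v} Su Sv = <-≤-trans (superlevel⁻ f t v Sv) (superlevel⁺ f t u Su)
    bounded : ∀ b u → when b (laplacian G f u) ≤ D u
    bounded true  u = Lf≤D u
    bounded false u = D-eff u

  isolated-peak⇒valence≤laplacian : ∀ {n} (G : Graph n) (f : Fin n → ℤ) z →
    (∀ u → superlevel f (f z) u ≡ true → u ≡ z) → + valence G z ≤ laplacian G f z
  isolated-peak⇒valence≤laplacian G f z only-z =
    strict-local-max⇒valence≤laplacian G f z (λ u z~u → superlevel⁻ f (f z) u (below u z~u))
    where
    below : ∀ u → adj G z u ≡ true → superlevel f (f z) u ≡ false
    below u z~u with superlevel f (f z) u in Su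
    ... | false = refl
    ... | true  = ⊥-elim (adj⇒≢ G z~u (sym (only-z u Su)))

  level-set-dichotomy : ∀ {n} (G : Graph n) {d} {D : Divisor n} → MinValenceAtLeast G d → n ℕ.< d ℕ.+ d →
    Effective D → (f : Fin n → ℤ) → (∀ v → laplacian G f v ≤ D v) → ∀ {x y} →
    laplacian G f x < 0ℤ → laplacian G f y ≤ 0ℤ → adj G x y ≡ true →
    (+ n - 1ℤ ≤ deg D) ⊎ (Σ (Fin n) λ z → (adj G x z ≡ true ⊎ adj G y z ≡ true) × + valence G z ≤ D z)
  level-set-dichotomy G δ n<2d D-eff f Lf≤D {x} {y} Lx<0 Ly≤0 x~y with climb G f Lx<0 Ly≤0 x~y
  ... | z , z~xy , fx<fz , fy<fz
    with any? (λ u → (superlevel f (f z) u Bool.≟ true) ×-dec ¬? (u Fin.≟ z))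
  ...   | yes (z′ , z′∈S , z′≢z) = inj₁ (superlevel-cut⇒deg≥ G f (f z) δ n<2d D-eff Lf≤D
            (card≥2 {P = superlevel f (f z)} z′∈S (dec-true (f z ≤? f z) ≤-refl) z′≢z)
            (card≥2 {P = not ∘ superlevel f (f z)} (cong not (dec-false (f z ≤? f x) (<⇒≱ fx<fz)))
                                                   (cong not (dec-false (f z ≤? f y) (<⇒≱ fy<fz)))
                                                   (adj⇒≢ G x~y)))
  ...   | no no-other = inj₂ (z , z~xy , ≤-trans (isolated-peak⇒valence≤laplacian G f z only-z) (Lf≤D z))
    where
    only-z : ∀ u → superlevel f (f z) u ≡ true → u ≡ z
    only-z u Su with u Fin.≟ z
    ... | yes u≡z = u≡z
    ... | no u≢z  = ⊥-elim (no-other (u , Su , u≢z))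

  module BelowBound {n} (G : Graph n) {d α} (δ : MinValenceAtLeast G d) (n<2d : n ℕ.< d ℕ.+ d)
    (α-max : ∀ S → Independent G S → ∣ S ∣ ℕ.≤ α) (α≥1 : 1 ℕ.≤ α)
    {D : Divisor n} (D-eff : Effective D) (reach : ∀ x → Reaches G D x) (small : deg D < + n - + α) where

    Z : Fin n → Bool
    Z v = does (D v ≟ 0ℤ)

    Z⇒0 : ∀ {v} → Z v ≡ true → D v ≡ 0ℤ
    Z⇒0 {v} _ with D v ≟ 0ℤ
    Z⇒0 {v} _  | yes Dv≡0 = Dv≡0
    Z⇒0 {v} () | no _

    𝟙-∁Z≤D : ∀ v → 𝟙 (not (Z v)) ≤ D v
    𝟙-∁Z≤D v with D v ≟ 0ℤ
    ... | yes _    = D-eff v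
    ... | no Dv≢0  = i<j⇒suc[i]≤j (≤∧≢⇒< (D-eff v) (Dv≢0 ∘ sym))

    α<n-deg : + α < + n - deg D
    α<n-deg = ≤-<-trans (≤-reflexive (sym (cancel (+ n) (+ α)))) (+-monoʳ-< (+ n) (neg-mono-< small))
      where
      cancel : ∀ a b → a - (a - b) ≡ b
      cancel = solve-∀

    deg<n-1 : deg D < + n - 1ℤ
    deg<n-1 = <-≤-trans small (+-monoʳ-≤ (+ n) (neg-mono-≤ (+≤+ α≥1)))

    zero-edge⇒heavy : ∀ {x y} → Z x ≡ true → Z y ≡ true → adj G x y ≡ true →
      Σ (Fin n) λ z → (adj G x z ≡ true ⊎ adj G y z ≡ true) × + valence G z ≤ D z
    zero-edge⇒heavy {x} {y} Zx Zy x~y with reach x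
    ... | f , fired-eff , chip-on-x =
      [ (λ n-1≤deg → ⊥-elim (<⇒≱ deg<n-1 n-1≤deg)) , (λ heavy → heavy) ]′
      (level-set-dichotomy G δ n<2d D-eff f Lf≤D Lx<0 Ly≤0 x~y)
      where
      Lf≤D : ∀ v → laplacian G f v ≤ D v
      Lf≤D v = 0≤i-j⇒j≤i (fired-eff v)
      Lx<0 : laplacian G f x < 0ℤ
      Lx<0 = 1≤-⇒< (subst (λ c → 1ℤ ≤ c - laplacian G f x) (Z⇒0 Zx) chip-on-x)
      Ly≤0 : laplacian G f y ≤ 0ℤ
      Ly≤0 = subst (laplacian G f y ≤_) (Z⇒0 Zy) (Lf≤D y)

    card∁Z≤deg : card (not ∘ Z) ≤ deg D
    card∁Z≤deg = ≤-trans (sum-mono 𝟙-∁Z≤D) (≤-reflexive (sym (sumℤ≡sum n D)))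

    α<card-Z : + α < card Z
    α<card-Z = begin-strict
      + α                                          <⟨ α<n-deg ⟩
      + n - deg D                                  ≤⟨ +-monoʳ-≤ (+ n) (neg-mono-≤ card∁Z≤deg) ⟩
      + n - card (not ∘ Z)                         ≡⟨ cong (_- card (not ∘ Z)) (sym (card-∁ Z)) ⟩
      (card Z + card (not ∘ Z)) - card (not ∘ Z)   ≡⟨ ∁-cancel (card Z) (card (not ∘ Z)) ⟩
      card Z                                       ∎
      where
      open ≤-Reasoning
      ∁-cancel : ∀ a b → (a + b) - b ≡ a
      ∁-cancel = solve-∀

    no-heavy⇒⊥ : (∀ z → D z < + valence G z) → ⊥
    no-heavy⇒⊥ light with large-set-has-edge G α-max Z α<card-Z
    ... | x , y , Zx , Zy , x~y with zero-edge⇒heavy Zx Zy x~y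
    ...   | z , _ , heavy = <⇒≱ (light z) heavy

    module Heavy {w} (heavy : + valence G w ≤ D w) where

      w∉Z : Z w ≡ false
      w∉Z with Z w in Zw
      ... | false = refl
      ... | true  = ⊥-elim (<⇒≱ (+<+ (ℕ.s≤s ℕ.z≤n))
                      (≤-trans (+≤+ (positive-valence G δ n<2d w)) (≤-trans heavy (≤-reflexive (Z⇒0 Zw)))))

      I : Fin n → Bool
      I v = (Z v ∧ not (adj G w v)) ∨ does (v Fin.≟ w)

      I∖w : ∀ {v} → I v ≡ true → v ≢ w → Z v ≡ true × adj G w v ≡ false
      I∖w {v} Iv v≢w = split (Z v) (adj G w v)
        (trans (cong (λ b → (Z v ∧ not (adj G w v)) ∨ b) (sym (dec-false (v Fin.≟ w) v≢w))) Iv)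
        where
        split : ∀ z a → (z ∧ not a) ∨ false ≡ true → z ≡ true × a ≡ false
        split true  false _ = refl , refl

      card-Z+1-val≤card-I : card Z + 1ℤ - + valence G w ≤ card I
      card-Z+1-val≤card-I = begin
        card Z + 1ℤ - + valence G w
          ≡⟨ cong₂ (λ a b → card Z + a - b) (sym (sum-χ w)) (countTrue≡card (adj G w)) ⟩
        card Z + sum (χ w) - card (adj G w)
          ≡⟨ cong (_- card (adj G w)) (sym (∑-distrib-+ (𝟙 ∘ Z) (χ w))) ⟩
        sum (λ v → 𝟙 (Z v) + χ w v) - card (adj G w)
          ≡⟨ sym (∑-distrib-minus (λ v → 𝟙 (Z v) + χ w v) (𝟙 ∘ adj G w)) ⟩
        sum (λ v → 𝟙 (Z v) + χ w v - 𝟙 (adj G w v))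
          ≤⟨ sum-mono count ⟩
        card I
          ∎
        where
        open ≤-Reasoning
        count : ∀ v → 𝟙 (Z v) + χ w v - 𝟙 (adj G w v) ≤ 𝟙 ((Z v ∧ not (adj G w v)) ∨ does (v Fin.≟ w))
        count v with v Fin.≟ w
        ... | yes refl rewrite w∉Z | Graph.irrefl G w = ≤-refl
        ... | no _ = other (Z v) (adj G w v)
          where
          other : ∀ z a → 𝟙 z + 0ℤ - 𝟙 a ≤ 𝟙 ((z ∧ not a) ∨ false)
          other true  true  = ≤-refl
          other true  false = ≤-refl
          other false true  = -≤+
          other false false = ≤-refl

      card∁Z+Dw-1≤deg : card (not ∘ Z) + (D w - 1ℤ) ≤ deg D
      card∁Z+Dw-1≤deg = begin
        card (not ∘ Z) + (D w - 1ℤ)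
          ≡⟨ cong (_+_ (card (not ∘ Z))) (sym (sum-χ* w (λ v → D v - 1ℤ))) ⟩
        card (not ∘ Z) + sum (λ v → χ w v * (D v - 1ℤ))
          ≡⟨ sym (∑-distrib-+ (𝟙 ∘ not ∘ Z) (λ v → χ w v * (D v - 1ℤ))) ⟩
        sum (λ v → 𝟙 (not (Z v)) + χ w v * (D v - 1ℤ))
          ≤⟨ sum-mono count ⟩
        sum D
          ≡⟨ sym (sumℤ≡sum n D) ⟩
        deg D
          ∎
        where
        open ≤-Reasoning
        unit : ∀ x → 1ℤ + 1ℤ * (x - 1ℤ) ≡ x
        unit = solve-∀
        count : ∀ v → 𝟙 (not (Z v)) + χ w v * (D v - 1ℤ) ≤ D v
        count v with v Fin.≟ w
        ... | yes refl rewrite w∉Z = ≤-reflexive (unit (D w))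
        ... | no _ = ≤-trans (≤-reflexive (+-identityʳ _)) (𝟙-∁Z≤D v)

      α<card-I : + α < card I
      α<card-I = begin-strict
        + α
          <⟨ α<n-deg ⟩
        + n - deg D
          ≤⟨ +-monoʳ-≤ (+ n) (neg-mono-≤ card∁Z+Dw-1≤deg) ⟩
        + n - (card (not ∘ Z) + (D w - 1ℤ))
          ≡⟨ cong (_- (card (not ∘ Z) + (D w - 1ℤ))) (sym (card-∁ Z)) ⟩
        (card Z + card (not ∘ Z)) - (card (not ∘ Z) + (D w - 1ℤ))
          ≡⟨ rearrange (card Z) (card (not ∘ Z)) (D w) ⟩
        card Z + 1ℤ - D w
          ≤⟨ +-monoʳ-≤ (card Z + 1ℤ) (neg-mono-≤ heavy) ⟩
        card Z + 1ℤ - + valence G w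
          ≤⟨ card-Z+1-val≤card-I ⟩
        card I
          ∎
        where
        open ≤-Reasoning
        rearrange : ∀ z c e → (z + c) - (c + (e - 1ℤ)) ≡ z + 1ℤ - e
        rearrange = solve-∀

      endpoint≢w : ∀ {x y} → I y ≡ true → adj G x y ≡ true → x ≢ w
      endpoint≢w Iy x~y refl = true≢false (trans (sym x~y) (proj₂ (I∖w Iy (λ y≡w → adj⇒≢ G x~y (sym y≡w)))))

      neighbour≢w : ∀ {v z} → adj G w v ≡ false → adj G v z ≡ true → z ≢ w
      neighbour≢w {v} w≁v v~z refl = true≢false (trans (sym v~z) (trans (Graph.sym G v w) w≁v))

      contradiction : ⊥
      contradiction with large-set-has-edge G α-max I α<card-I
      ... | x , y , Ix , Iy , x~y = second-heavy⇒⊥ (zero-edge⇒heavy (proj₁ Zx) (proj₁ Zy) x~y)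
        where
        Zx : Z x ≡ true × adj G w x ≡ false
        Zx = I∖w Ix (endpoint≢w Iy x~y)
        Zy : Z y ≡ true × adj G w y ≡ false
        Zy = I∖w Iy (endpoint≢w Ix (trans (Graph.sym G y x) x~y))
        second-heavy⇒⊥ : (Σ (Fin n) λ z → (adj G x z ≡ true ⊎ adj G y z ≡ true) × + valence G z ≤ D z) → ⊥
        second-heavy⇒⊥ (z , z~xy , heavy-z) = <-irrefl refl (begin-strict
          + n                              <⟨ n<d+d⇒ℤ {d = d} n<2d ⟩
          + d + + d                        ≤⟨ +-mono-≤ (+≤+ (δ z)) (+≤+ (δ w)) ⟩
          + valence G z + + valence G w    ≤⟨ +-mono-≤ heavy-z heavy ⟩
          D z + D w                        ≤⟨ two-terms≤sum D-eff z≢w ⟩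
          sum D                            ≡⟨ sym (sumℤ≡sum n D) ⟩
          deg D                            <⟨ small ⟩
          + n - + α                        ≤⟨ i-j≤i (+ n) (+ α) ⟩
          + n                              ∎)
          where
          open ≤-Reasoning
          z≢w : z ≢ w
          z≢w = [ neighbour≢w (proj₂ Zx) , neighbour≢w (proj₂ Zy) ]′ z~xy

    contradiction : ⊥
    contradiction with any? (λ w → + valence G w ≤? D w)
    ... | yes (w , heavy) = Heavy.contradiction heavy
    ... | no no-heavy     = no-heavy⇒⊥ (λ z → ≰⇒> (λ heavy → no-heavy (z , heavy)))

  lower-bound : ∀ {n} (G : Graph n) {d α} → MinValenceAtLeast G d → n ℕ.< d ℕ.+ d →
    (∀ S → Independent G S → ∣ S ∣ ℕ.≤ α) → 1 ℕ.≤ α →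
    ∀ {D} → Effective D → (∀ x → Reaches G D x) → + n - + α ≤ deg D
  lower-bound {n} G {α = α} δ n<2d α-max α≥1 {D} D-eff reach with + n - + α ≤? deg D
  ... | yes bound = bound
  ... | no ¬bound = ⊥-elim (BelowBound.contradiction G δ n<2d α-max α≥1 D-eff reach (≰⇒> ¬bound))

  positiveRank⇒n∸α≤deg : ∀ {n} (G : Graph n) {d α} → MinValenceAtLeast G d → n ℕ.< d ℕ.+ d → 1 ℕ.≤ n →
    IsIndependenceNumber G α → ∀ {D} → PositiveRank G D → + (n ℕ.∸ α) ≤ deg D
  positiveRank⇒n∸α≤deg {n} G {α = α} δ n<2d 1≤n ((S , _ , ∣S∣≡α) , α-max) {D} D-positive =
    from-representative (positiveRank⇒reaching-representative G D-positive)
    where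
    from-representative : ReachingRepresentative G D → + (n ℕ.∸ α) ≤ deg D
    from-representative (D₀ , D₀-eff , deg≡ , reach) = begin
      + (n ℕ.∸ α)   ≡⟨ pos-∸ (subst (ℕ._≤ n) ∣S∣≡α (∣p∣≤n S)) ⟩
      + n - + α     ≤⟨ lower-bound G δ n<2d α-max (independenceNumber≥1 G 1≤n α-max) D₀-eff reach ⟩
      deg D₀        ≡⟨ deg≡ ⟩
      deg D         ∎
      where open ≤-Reasoning

open import Data.Nat using (ℕ; _≤_; _<_; _+_; _*_; _∸_; _/_; _%_)
open import Data.Nat.DivMod using (m≡m%n+[m/n]*n; m%n<n)
import Data.Nat.Properties as ℕP
open import Data.Nat.Tactic.RingSolver using (solve-∀)
open import Data.Product using (_×_; _,_)
import Data.Integer as ℤ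
open import Defs
open import Relation.Binary.PropositionalEquality using (_≡_; subst)
open Gonality
  using (complementDivisor; complementDivisor-multFree; complementDivisor-deg; complementDivisor-rank≥1;
         positive-valence; positiveRank⇒n∸α≤deg)

n<2[n/2+1] : ∀ n → n < n / 2 + 1 + (n / 2 + 1)
n<2[n/2+1] n = begin-strict
  n                         ≡⟨ m≡m%n+[m/n]*n n 2 ⟩
  n % 2 + n / 2 * 2         <⟨ ℕP.+-monoˡ-< (n / 2 * 2) (m%n<n n 2) ⟩
  2 + n / 2 * 2             ≡⟨ double (n / 2) ⟩
  n / 2 + 1 + (n / 2 + 1)   ∎
  where
  open ℕP.≤-Reasoning
  double : ∀ q → 2 + q * 2 ≡ q + 1 + (q + 1)
  double = solve-∀

corollary5p6 : (n : ℕ) → (G : Graph n) → 1 ≤ n → Connected G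
    → MinValenceAtLeast G (n / 2 + 1)
    → (a : ℕ) → IsIndependenceNumber G a
    → IsGonality G (n ∸ a) × IsMFGonality G (n ∸ a)
corollary5p6 n G 1≤n _ δ a α@((S , S-indep , ∣S∣≡a) , _) =
  ((D , D-positive , D-deg) , deg≥) , ((D , complementDivisor-multFree S , D-positive , D-deg) , λ D′ _ → deg≥ D′)
  where
  n<2d : n < n / 2 + 1 + (n / 2 + 1)
  n<2d = n<2[n/2+1] n
  D : Divisor n
  D = complementDivisor S
  D-positive : PositiveRank G D
  D-positive = 1 , ℕP.≤-refl , complementDivisor-rank≥1 G S-indep (positive-valence G δ n<2d)
  D-deg : deg D ≡ ℤ.+ (n ∸ a)
  D-deg = subst (λ m → deg D ≡ ℤ.+ (n ∸ m)) ∣S∣≡a (complementDivisor-deg S)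
  deg≥ : ∀ D′ → PositiveRank G D′ → ℤ.+ (n ∸ a) ℤ.≤ deg D′
  deg≥ D′ = positiveRank⇒n∸α≤deg G δ n<2d 1≤n α
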